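{- If $G$ is a graph with ${\rm diam}(G) = 2$, then $\chi_{\rho}(M(G)) = 2n(G) - \alpha(M(G)) + 2$.
   Context: All graphs are finite and simple; $n(G)$ is the number of vertices of $G$, ${\rm diam}(G)$ its diameter, and $\alpha(H)$ the independence number of $H$. For a positive integer $i$, an $i$-packing in $G$ is a set $W\subseteq V(G)$ such that any two distinct vertices of $W$ are at distance greater than $i$ in $G$. The packing chromatic number $\chi_{\rho}(G)$ is the smallest integer $k$ such that $V(G)$ can be partitioned into sets $V_1,\dots,V_k$ with $V_i$ an $i$-packing for each $i\in\{1,\dots,k\}$. The Mycielskian $M(G)$ of $G$ is the graph with vertex set $V(G)\cup V'\cup\{w\}$, where $V'=\{x' : x\in V(G)\}$ is a set of new vertices and $w$ is a further new vertex, and edge set $E(G)\cup\{xy' : xy\in E(G)\}\cup\{wx' : x'\in V'\}$. -}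

module Defs where

open import Data.Nat using (ℕ; zero; suc; _+_; _<_)
open import Data.Bool using (Bool; true; false)
open import Data.Fin using (Fin; zero; suc; toℕ; splitAt)
open import Data.Fin.Subset using (Subset; _∈_; ∣_∣)
open import Data.Sum using (inj₁; inj₂)
open import Data.Product using (Σ; _×_; _,_; ∃₂)
open import Relation.Nullary using (¬_)
open import Relation.Binary.PropositionalEquality using (_≡_; _≢_; refl)

record Graph (n : ℕ) : Set where
  field
    adj    : Fin n → Fin n → Bool
    sym    : ∀ x y → adj x y ≡ adj y x
    irrefl : ∀ x → adj x x ≡ false
open Graph public

-- Within G k x y : there is a walk of length at most k from x to y,
-- i.e. d_G(x,y) ≤ k.
data Within {n : ℕ} (G : Graph n) : ℕ → Fin n → Fin n → Set where
  here : ∀ {k x} → Within G k x x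
  step : ∀ {k x y z} → adj G x z ≡ true → Within G k z y → Within G (suc k) x y

HasDiameter : ∀ {n} → Graph n → ℕ → Set
HasDiameter G d =
  (∀ x y → Within G d x y) × ∃₂ (λ x y → ∀ k → k < d → ¬ Within G k x y)

IsPacking : ∀ {n} → Graph n → ℕ → (Fin n → Set) → Set
IsPacking G i W = ∀ x y → W x → W y → x ≢ y → ¬ Within G i x y

-- A packing k-colouring: a map c into k colours (colour j ∈ Fin k stands for
-- the class V_{j+1}), such that each class V_i = c⁻¹(i-1) is an i-packing.
IsPackingColouring : ∀ {n} → Graph n → (k : ℕ) → (Fin n → Fin k) → Set
IsPackingColouring G k c =
  (j : Fin k) → IsPacking G (suc (toℕ j)) (λ x → c x ≡ j)

HasPackingColouring : ∀ {n} → Graph n → ℕ → Set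
HasPackingColouring {n} G k = Σ (Fin n → Fin k) (IsPackingColouring G k)

IsPackingChromaticNumber : ∀ {n} → Graph n → ℕ → Set
IsPackingChromaticNumber G k =
  HasPackingColouring G k × (∀ m → HasPackingColouring G m → k Data.Nat.≤ m)

IsIndependent : ∀ {n} → Graph n → Subset n → Set
IsIndependent G S = ∀ x y → x ∈ S → y ∈ S → adj G x y ≡ false

IsIndependenceNumber : ∀ {n} → Graph n → ℕ → Set
IsIndependenceNumber {n} G a =
  Σ (Subset n) (λ S → IsIndependent G S × ∣ S ∣ ≡ a)
  × (∀ S → IsIndependent G S → ∣ S ∣ Data.Nat.≤ a)

data MV (n : ℕ) : Set where
  w    : MV n
  orig : Fin n → MV n
  copy : Fin n → MV n

madj : ∀ {n} → Graph n → MV n → MV n → Bool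
madj G w        w        = false
madj G w        (orig _) = false
madj G w        (copy _) = true
madj G (orig _) w        = false
madj G (orig x) (orig y) = adj G x y
madj G (orig x) (copy y) = adj G x y
madj G (copy _) w        = true
madj G (copy x) (orig y) = adj G x y
madj G (copy _) (copy _) = false

madj-sym : ∀ {n} (G : Graph n) u v → madj G u v ≡ madj G v u
madj-sym G w        w        = refl
madj-sym G w        (orig _) = refl
madj-sym G w        (copy _) = refl
madj-sym G (orig _) w        = refl
madj-sym G (orig x) (orig y) = sym G x y
madj-sym G (orig x) (copy y) = sym G x y
madj-sym G (copy _) w        = refl
madj-sym G (copy x) (orig y) = sym G x y
madj-sym G (copy _) (copy _) = refl

madj-irrefl : ∀ {n} (G : Graph n) u → madj G u u ≡ false
madj-irrefl G w        = refl
madj-irrefl G (orig x) = irrefl G x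
madj-irrefl G (copy _) = refl

-- Encoding of V(M(G)) as Fin (1 + (n + n)): 0 ↦ w, 1+i ↦ x_i, 1+n+i ↦ x_i'.
decode : ∀ {n} → Fin (suc (n + n)) → MV n
decode         zero    = w
decode {n}     (suc i) with splitAt n i
... | inj₁ x = orig x
... | inj₂ x = copy x

Mycielskian : ∀ {n} → Graph n → Graph (suc (n + n))
Mycielskian G = record
  { adj    = λ x y → madj G (decode x) (decode y)
  ; sym    = λ x y → madj-sym G (decode x) (decode y)
  ; irrefl = λ x → madj-irrefl G (decode x)
  }

module Submission where

-- Let H be a graph on N ≥ 1 vertices in which any two vertices
-- are at distance at most 2.  In a packing colouring of H every class V_i with
-- i ≥ 2 is an i-packing, hence contains at most one vertex, while V_1 is an
-- independent set.  So χ_ρ(H) ≥ 1 + (N - α(H)); conversely, colouring a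
-- maximum independent set with colour 1 and every remaining vertex with its
-- own colour is a packing colouring, so χ_ρ(H) = N - α(H) + 1.
-- If diam(G) = 2 then G has no isolated vertex, and then any two vertices of
-- M(G) are at distance at most 2; applied to H = M(G) with N = 2n + 1 this is
-- the corollary.

open import Defs hiding (sym)
open import Data.Nat using (ℕ; zero; suc; _+_; _*_; _∸_; _≤_; z≤n; s≤s)
open import Data.Nat.Properties
  using (≤-antisym; +-comm; +-identityʳ; +-mono-≤; +-monoˡ-≤; m+[n∸m]≡n; m∸n+n≡m; module ≤-Reasoning)
open import Data.Bool using (true; false)
open import Data.Fin using (Fin; zero; suc; toℕ; splitAt; _↑ˡ_; _↑ʳ_; punchOut)
open import Data.Fin.Properties
  using (_≟_; suc-injective; injective⇒≤; punchOut-injective; splitAt-↑ˡ; splitAt-↑ʳ; splitAt⁻¹-↑ˡ; splitAt⁻¹-↑ʳ)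
open import Data.Fin.Subset using (Subset; _∈_; ∣_∣; ∁)
open import Data.Fin.Subset.Properties using (_∈?_; x∉p⇒x∈∁p; x∈∁p⇒x∉p; ∣∁p∣≡n∸∣p∣; ∣p∣≤n)
open import Data.Vec using (_∷_; tabulate)
open import Data.Vec.Base using (here; there)
open import Data.Vec.Properties using ([]=⇒lookup; lookup⇒[]=; lookup∘tabulate)
open import Data.Product using (Σ; _×_; _,_; proj₁; proj₂)
open import Data.Sum using (_⊎_; inj₁; inj₂)
open import Data.Empty using (⊥-elim)
open import Relation.Nullary using (¬_; Dec; does; yes; no)
open import Relation.Unary using (Pred; Decidable)
open import Relation.Binary.PropositionalEquality

member : ∀ {N} (p : Subset N) → Fin ∣ p ∣ → Fin N
member (true  ∷ p) zero    = zero
member (true  ∷ p) (suc i) = suc (member p i)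
member (false ∷ p) i       = suc (member p i)

member-∈ : ∀ {N} (p : Subset N) i → member p i ∈ p
member-∈ (true  ∷ p) zero    = here
member-∈ (true  ∷ p) (suc i) = there (member-∈ p i)
member-∈ (false ∷ p) i       = there (member-∈ p i)

member-injective : ∀ {N} (p : Subset N) {i j} → member p i ≡ member p j → i ≡ j
member-injective (true  ∷ p) {zero}  {zero}  _ = refl
member-injective (true  ∷ p) {suc i} {suc j} e = cong suc (member-injective p (suc-injective e))
member-injective (false ∷ p)                 e = member-injective p (suc-injective e)

rank : ∀ {N} (p : Subset N) x → x ∈ p → Fin ∣ p ∣
rank (true  ∷ p) zero    here      = zero
rank (true  ∷ p) (suc x) (there h) = suc (rank p x h)
rank (false ∷ p) (suc x) (there h) = rank p x h

rank-injective : ∀ {N} (p : Subset N) x y hx hy → rank p x hx ≡ rank p y hy → x ≡ y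
rank-injective (true  ∷ p) zero    zero    here       here       _ = refl
rank-injective (true  ∷ p) (suc x) (suc y) (there hx) (there hy) e =
  cong suc (rank-injective p x y hx hy (suc-injective e))
rank-injective (false ∷ p) (suc x) (suc y) (there hx) (there hy) e =
  cong suc (rank-injective p x y hx hy e)

injection-bound : ∀ {N m} (p : Subset N) (f : ∀ x → x ∈ p → Fin m) →
  (∀ x y hx hy → f x hx ≡ f y hy → x ≡ y) → ∣ p ∣ ≤ m
injection-bound p f f-inj =
  injective⇒≤ (λ e → member-injective p (f-inj _ _ (member-∈ p _) (member-∈ p _) e))

subset+complement : ∀ {N} (p : Subset N) → ∣ p ∣ + ∣ ∁ p ∣ ≡ N
subset+complement p = trans (cong (∣ p ∣ +_) (∣∁p∣≡n∸∣p∣ p)) (m+[n∸m]≡n (∣p∣≤n p))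

select : ∀ {N ℓ} {P : Pred (Fin N) ℓ} → Decidable P → Subset N
select P? = tabulate (λ x → does (P? x))

module _ {N ℓ} {P : Pred (Fin N) ℓ} (P? : Decidable P) where

  select-sound : ∀ x → x ∈ select P? → P x
  select-sound x h = witness (P? x) (trans (sym (lookup∘tabulate _ x)) ([]=⇒lookup h))
    where
    witness : ∀ {A : Set ℓ} (d : Dec A) → does d ≡ true → A
    witness (yes a) _ = a

  select-complete : ∀ x → P x → x ∈ select P?
  select-complete x px = lookup⇒[]= x (select P?) (trans (lookup∘tabulate _ x) (holds (P? x)))
    where
    holds : (d : Dec (P x)) → does d ≡ true
    holds (yes _)  = refl
    holds (no ¬px) = ⊥-elim (¬px px)

module _ {N : ℕ} (H : Graph N) where

  Within-mono : ∀ {k m x y} → k ≤ m → Within H k x y → Within H m x y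
  Within-mono _         here       = here
  Within-mono (s≤s k≤m) (step e r) = step e (Within-mono k≤m r)

  Within1⇒adjacent : ∀ {x y} → Within H 1 x y → x ≢ y → adj H x y ≡ true
  Within1⇒adjacent here         x≢y = ⊥-elim (x≢y refl)
  Within1⇒adjacent (step e here) _  = e

  packing⇒independent : ∀ {W} → IsPacking H 1 W → ∀ x y → W x → W y → adj H x y ≡ false
  packing⇒independent pack x y wx wy with adj H x y in e
  ... | false = refl
  ... | true with x ≟ y
  ...   | yes refl = trans (sym e) (irrefl H x)
  ...   | no x≢y   = ⊥-elim (pack x y wx wy x≢y (step e here))

  independent⇒packing : ∀ {W} → (∀ x y → W x → W y → adj H x y ≡ false) → IsPacking H 1 W
  independent⇒packing ind x y wx wy x≢y r
    with () ← trans (sym (Within1⇒adjacent r x≢y)) (ind x y wx wy)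

  packing-beyond-diameter : ∀ {d i W} → (∀ x y → Within H d x y) → d ≤ i →
    IsPacking H i W → ∀ x y → W x → W y → x ≡ y
  packing-beyond-diameter close d≤i pack x y wx wy with x ≟ y
  ... | yes x≡y = x≡y
  ... | no x≢y  = ⊥-elim (pack x y wx wy x≢y (Within-mono d≤i (close x y)))

-- Colour classes other than the first are i-packings with i ≥ 2.
nonzero⇒2≤ : ∀ {k} (j : Fin (suc k)) → zero ≢ j → 2 ≤ suc (toℕ j)
nonzero⇒2≤ zero    0≢0 = ⊥-elim (0≢0 refl)
nonzero⇒2≤ (suc j) _   = s≤s (s≤s z≤n)

module _ {N : ℕ} (H : Graph N) (close : ∀ x y → Within H 2 x y) where

  -- A packing colouring uses colour 1 on an independent set and pairwise
  -- distinct colours elsewhere, so N ≤ α(H) + (χ_ρ(H) - 1).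
  colours-lower-bound : ∀ {k a} → HasPackingColouring H (suc k) →
    IsIndependenceNumber H a → N ≤ a + k
  colours-lower-bound {k} {a} (c , pack) (_ , maximal) = begin
    N                   ≡⟨ sym (subset+complement first) ⟩
    ∣ first ∣ + ∣ rest ∣ ≤⟨ +-mono-≤ (maximal first first-independent) rest-bound ⟩
    a + k               ∎
    where
    open ≤-Reasoning
    first? : Decidable (λ x → zero ≡ c x)
    first? x = zero ≟ c x

    first : Subset N
    first = select first?
    rest : Subset N
    rest = ∁ first

    first-independent : IsIndependent H first
    first-independent x y hx hy = packing⇒independent H (pack zero) x y
      (sym (select-sound first? x hx)) (sym (select-sound first? y hy))

    -- Outside the first class, colours are nonzero; drop colour 1.
    nonzero : ∀ x → x ∈ rest → zero ≢ c x
    nonzero x hx e = x∈∁p⇒x∉p hx (select-complete first? x e)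

    shifted : ∀ x → x ∈ rest → Fin k
    shifted x hx = punchOut (nonzero x hx)

    shifted-injective : ∀ x y hx hy → shifted x hx ≡ shifted y hy → x ≡ y
    shifted-injective x y hx hy e =
      packing-beyond-diameter H close (nonzero⇒2≤ (c x) (nonzero x hx)) (pack (c x))
        x y refl (sym (punchOut-injective (nonzero x hx) (nonzero y hy) e))

    rest-bound : ∣ rest ∣ ≤ k
    rest-bound = injection-bound rest shifted shifted-injective

  -- Colour a maximum independent set S with colour 1 and each vertex outside
  -- S with a colour of its own: a packing colouring with 1 + (N - α) colours.
  colouring-from-independent : ∀ a → IsIndependenceNumber H a → HasPackingColouring H (suc (N ∸ a))
  colouring-from-independent a ((S , independent , size) , _) =
    subst (λ m → HasPackingColouring H (suc m)) rest-size (colour , valid)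
    where
    rest = ∁ S

    rest-size : ∣ rest ∣ ≡ N ∸ a
    rest-size = trans (∣∁p∣≡n∸∣p∣ S) (cong (N ∸_) size)

    colour-by : ∀ x → Dec (x ∈ S) → Fin (suc ∣ rest ∣)
    colour-by x (yes _)  = zero
    colour-by x (no x∉S) = suc (rank rest x (x∉p⇒x∈∁p x∉S))

    colour : Fin N → Fin (suc ∣ rest ∣)
    colour x = colour-by x (x ∈? S)

    same-colour : ∀ x y dx dy → colour-by x dx ≡ colour-by y dy →
      (colour-by x dx ≡ zero × x ∈ S × y ∈ S) ⊎ x ≡ y
    same-colour x y (yes x∈S) (yes y∈S) _ = inj₁ (refl , x∈S , y∈S)
    same-colour x y (no _)    (no _)    e = inj₂ (rank-injective rest x y _ _ (suc-injective e))

    valid : IsPackingColouring H (suc ∣ rest ∣) colour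
    valid j x y refl cy x≢y with same-colour x y (x ∈? S) (y ∈? S) (sym cy)
    ... | inj₂ x≡y                 = ⊥-elim (x≢y x≡y)
    ... | inj₁ (class₁ , x∈S , y∈S) =
      subst (λ j → ¬ Within H (suc (toℕ j)) x y) (sym class₁)
        (independent⇒packing H independent x y x∈S y∈S x≢y)

  -- The identity χ_ρ(H) + α(H) = N + 1 for H nonempty (the vertex x₀ rules
  -- out a colouring with no colours), by the two bounds above.
  packing+independence : Fin N → ∀ k a → IsPackingChromaticNumber H k →
    IsIndependenceNumber H a → k + a ≡ suc N
  packing+independence x₀ zero    a ((c , _) , _) _ with () ← c x₀
  packing+independence x₀ (suc k) a (colouring , minimal) α@((S , _ , size) , _) =
    ≤-antisym upper lower
    where
    a≤N : a ≤ N
    a≤N = subst (_≤ N) size (∣p∣≤n S)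

    upper : suc k + a ≤ suc N
    upper = begin
      suc k + a       ≤⟨ +-monoˡ-≤ a (minimal _ (colouring-from-independent a α)) ⟩
      suc (N ∸ a) + a ≡⟨ cong suc (m∸n+n≡m a≤N) ⟩
      suc N           ∎
      where open ≤-Reasoning

    lower : suc N ≤ suc k + a
    lower = s≤s (subst (N ≤_) (+-comm a k) (colours-lower-bound colouring α))

encode : ∀ {n} → MV n → Fin (suc (n + n))
encode     w        = zero
encode {n} (orig x) = suc (x ↑ˡ n)
encode {n} (copy x) = suc (n ↑ʳ x)

decode-encode : ∀ {n} (u : MV n) → decode (encode u) ≡ u
decode-encode     w                              = refl
decode-encode {n} (orig x) rewrite splitAt-↑ˡ n x n = refl
decode-encode {n} (copy x) rewrite splitAt-↑ʳ n n x = refl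

encode-decode : ∀ {n} (i : Fin (suc (n + n))) → encode {n} (decode {n} i) ≡ i
encode-decode     zero    = refl
encode-decode {n} (suc i) with splitAt n i in e
... | inj₁ _ = cong {A = Fin (n + n)} suc (splitAt⁻¹-↑ˡ e)
... | inj₂ _ = cong {A = Fin (n + n)} suc (splitAt⁻¹-↑ʳ e)

decode-injective : ∀ {n} (i j : Fin (suc (n + n))) → decode {n} i ≡ decode {n} j → i ≡ j
decode-injective {n} i j e =
  trans (sym (encode-decode {n} i)) (trans (cong (encode {n}) e) (encode-decode {n} j))

first-edge : ∀ {n k} (G : Graph n) {a b} → Within G k a b → a ≢ b → Σ (Fin n) (λ z → adj G a z ≡ true)
first-edge G here               a≢a = ⊥-elim (a≢a refl)
first-edge G (step {z = z} e _) _   = z , e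

-- A graph of positive diameter has no isolated vertex: every vertex differs
-- from one of the two ends of a diametral pair, and a walk to it starts
-- with an edge.
no-isolated : ∀ {n d} (G : Graph n) → HasDiameter G (suc d) → ∀ a → Σ (Fin n) (λ z → adj G a z ≡ true)
no-isolated G (within , p , q , far) a with a ≟ p
... | no a≢p    = first-edge G (within a p) a≢p
... | yes refl  = first-edge G (within a q) (λ a≡q → far 0 (s≤s z≤n) (subst (Within G 0 a) a≡q here))

module _ {n : ℕ} (G : Graph n) where

  data Reach2 (u v : MV n) : Set where
    equal    : u ≡ v → Reach2 u v
    adjacent : madj G u v ≡ true → Reach2 u v
    via      : ∀ m → madj G u m ≡ true → madj G m v ≡ true → Reach2 u v

  Reach2-swap : ∀ {u v} → Reach2 u v → Reach2 v u
  Reach2-swap         (equal e)    = equal (sym e)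
  Reach2-swap {u} {v} (adjacent e) = adjacent (trans (madj-sym G v u) e)
  Reach2-swap {u} {v} (via m e e′) = via m (trans (madj-sym G v m) e′) (trans (madj-sym G m u) e)

  Reach2⇒Within : ∀ x y → Reach2 (decode {n} x) (decode {n} y) → Within (Mycielskian G) 2 x y
  Reach2⇒Within x y (equal e)    = subst (Within (Mycielskian G) 2 x) (decode-injective x y e) here
  Reach2⇒Within x y (adjacent e) = step e here
  Reach2⇒Within x y (via m e e′) =
    step {z = encode m} (subst (λ u → madj G (decode x) u ≡ true) (sym (decode-encode m)) e)
      (step (subst (λ u → madj G u (decode y) ≡ true) (sym (decode-encode m)) e′) here)

  module _ (diam : HasDiameter G 2) where

    private
      neighbour : ∀ a → Fin n
      neighbour a = proj₁ (no-isolated G diam a)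

      to-neighbour : ∀ a → adj G a (neighbour a) ≡ true
      to-neighbour a = proj₂ (no-isolated G diam a)

      from-neighbour : ∀ a → adj G (neighbour a) a ≡ true
      from-neighbour a = trans (Graph.sym G (neighbour a) a) (to-neighbour a)

    -- A walk of length ≤ 2 in G between a and b lifts to M(G) from x_a to
    -- both x_b and x_b'; for a = b the latter detours through a neighbour.
    lift-orig : ∀ {a b} → Within G 2 a b → Reach2 (orig a) (orig b)
    lift-orig here                   = equal refl
    lift-orig (step e here)          = adjacent e
    lift-orig (step e (step e′ here)) = via (orig _) e e′

    lift-copy : ∀ {a b} → Within G 2 a b → Reach2 (orig a) (copy b)
    lift-copy {a} here               = via (orig (neighbour a)) (to-neighbour a) (from-neighbour a)
    lift-copy (step e here)          = adjacent e
    lift-copy (step e (step e′ here)) = via (orig _) e e′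

    reach2 : ∀ u v → Reach2 u v
    reach2 w        w        = equal refl
    reach2 w        (orig b) = via (copy (neighbour b)) refl (from-neighbour b)
    reach2 w        (copy b) = adjacent refl
    reach2 (orig a) w        = Reach2-swap (reach2 w (orig a))
    reach2 (orig a) (orig b) = lift-orig (proj₁ diam a b)
    reach2 (orig a) (copy b) = lift-copy (proj₁ diam a b)
    reach2 (copy a) w        = adjacent refl
    reach2 (copy a) (orig b) = Reach2-swap (lift-copy (proj₁ diam b a))
    reach2 (copy a) (copy b) = via w refl refl

    mycielskian-within2 : ∀ x y → Within (Mycielskian G) 2 x y
    mycielskian-within2 x y = Reach2⇒Within x y (reach2 (decode x) (decode y))

corollary2p6 : (n : ℕ) (G : Graph n) → HasDiameter G 2 →
    (k a : ℕ) → IsPackingChromaticNumber (Mycielskian G) k →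
    IsIndependenceNumber (Mycielskian G) a →
    k + a ≡ 2 * n + 2
corollary2p6 n G diam k a χ α = begin
  k + a               ≡⟨ packing+independence (Mycielskian G) (mycielskian-within2 G diam) zero k a χ α ⟩
  suc (suc (n + n))   ≡⟨ cong (λ m → suc (suc (n + m))) (sym (+-identityʳ n)) ⟩
  2 + 2 * n           ≡⟨ +-comm 2 (2 * n) ⟩
  2 * n + 2           ∎
  where open ≡-Reasoning
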